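{- Let $n\ge3$ and $k\ge2$. The map $\psi:[n-2]\times\mathcal{RSP}(n-2,k-1)\to\mathcal{RSP}^{(2)}(n,k)$, where $\psi(i,\pi)$ is obtained from $\pi$ by increasing by $1$ every entry greater than $i$ and then inserting the factor $n\,(i+1)$ immediately after the rightmost position holding an element of $\{1,\dots,i\}$, is a bijection.
   Context: A run of a permutation (in one-line notation) is a maximal increasing factor of consecutive letters. A permutation of $[m]$ is run-sorted if it is the concatenation of the blocks of a set partition of $[m]$ in block representation (elements of each block increasing, blocks ordered by increasing minima); equivalently, the minima of its successive runs are increasing. $\mathcal{RSP}(m,k)$ is the set of run-sorted permutations of $[m]$ with $k$ runs, and $\mathcal{RSP}^{(2)}(n,k)$ is the set of $\sigma\in\mathcal{RSP}(n,k)$ such that deleting the entry $n$ from $\sigma$ decreases the number of runs. -}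

module Defs where

open import Data.Nat using (ℕ; zero; suc; _<_; _≤_; _<ᵇ_; _≤ᵇ_; _<?_; _≡ᵇ_)
open import Data.Bool using (Bool; true; false; if_then_else_; _∧_; not)
open import Data.List using (List; []; _∷_; _++_; map; length; upTo)
open import Data.Bool.ListAction using (any)
open import Data.List.Relation.Binary.Permutation.Propositional using (_↭_)
open import Data.List.Relation.Unary.Linked using (Linked)
open import Data.Product using (_×_)
open import Relation.Nullary using (yes; no)
open import Relation.Binary.PropositionalEquality using (_≡_)

[_] : ℕ → List ℕ
[ m ] = map suc (upTo m)

IsPerm : ℕ → List ℕ → Set
IsPerm m σ = σ ↭ [ m ]

-- decomposition of a word into its runs (maximal increasing factors)
private
  addTo : ℕ → List (List ℕ) → List (List ℕ)
  addTo x [] = (x ∷ []) ∷ []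
  addTo x ([] ∷ rs) = (x ∷ []) ∷ [] ∷ rs
  addTo x ((y ∷ r) ∷ rs) with x <? y
  ... | yes _ = (x ∷ y ∷ r) ∷ rs
  ... | no  _ = (x ∷ []) ∷ (y ∷ r) ∷ rs

runs : List ℕ → List (List ℕ)
runs [] = []
runs (x ∷ xs) = addTo x (runs xs)

nruns : List ℕ → ℕ
nruns σ = length (runs σ)

-- minimum of a run (a run is increasing, so its minimum is its first letter)
runMin : List ℕ → ℕ
runMin [] = 0
runMin (x ∷ _) = x

RunSorted : List ℕ → Set
RunSorted σ = Linked _<_ (map runMin (runs σ))

IsRSP : ℕ → ℕ → List ℕ → Set
IsRSP m k σ = IsPerm m σ × RunSorted σ × nruns σ ≡ k

deleteEntry : ℕ → List ℕ → List ℕ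
deleteEntry n [] = []
deleteEntry n (x ∷ xs) = if x ≡ᵇ n then deleteEntry n xs else x ∷ deleteEntry n xs

IsRSP2 : ℕ → ℕ → List ℕ → Set
IsRSP2 n k σ = IsRSP n k σ × nruns (deleteEntry n σ) < nruns σ

insertAfterLast : (ℕ → Bool) → List ℕ → List ℕ → List ℕ
insertAfterLast p ws [] = []
insertAfterLast p ws (x ∷ xs) =
  if p x ∧ not (any p xs) then x ∷ ws ++ xs else x ∷ insertAfterLast p ws xs

ψ : ℕ → ℕ → List ℕ → List ℕ
ψ n i π = insertAfterLast (λ x → (1 ≤ᵇ x) ∧ (x ≤ᵇ i)) (n ∷ suc i ∷ [])
            (map (λ x → if i <ᵇ x then suc x else x) π)

{-# OPTIONS --safe #-}
module Submission where

-- Write σ ∈ RSP⁽²⁾(n,k) as L a n c R around its largest letter n: n is not first, since the first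
-- run minimum would then exceed the next one, and not last, since it would merely extend the run of a.
-- As a < n > c, deleting n lowers the number of runs exactly when a < c, and run-sortedness makes c
-- smaller than every letter of R. Hence with i = c − 1 the letter a is the last letter of L a R lying
-- in [1, i], which is where ψ inserts n c, and L a R is the image of a unique π ∈ RSP(n−2, k−1) under
-- x ↦ x + [x > i], an order embedding that preserves runs and their number.

open import Defs
open import Level using (Level)
open import Data.Bool using (Bool; true; false; T; _∧_; if_then_else_)
open import Data.Bool.Properties using (∧-zeroʳ; T-∧)
open import Data.Bool.ListAction using (any)
open import Data.Empty using (⊥-elim)
open import Data.Nat
  using (ℕ; zero; suc; _<_; _≤_; _∸_; _<ᵇ_; _≤ᵇ_; _≡ᵇ_; _<?_; _≤?_; _≟_; s≤s; z≤n)
open import Data.Nat.Properties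
  using (≤-refl; ≤-trans; ≤-pred; n≤1+n; m≤n⇒m≤1+n; <⇒≤; <-trans; ≤-<-trans; <-irrefl; <-asym;
         <-cmp; <⇒≢; <⇒≱; ≤⇒≯; ≰⇒>; ≤∧≢⇒<; n<1+n; m<n⇒m<1+n; suc-injective;
         <ᵇ⇒<; <⇒<ᵇ; ≤ᵇ⇒≤; ≤⇒≤ᵇ; ≡ᵇ⇒≡; ≡⇒≡ᵇ)
open import Data.List using (List; []; _∷_; _++_; _∷ʳ_; map; length; initLast; _∷ʳ′_)
open import Data.List.Properties using (length-map; ++-assoc; ∷-injectiveˡ; ∷-injectiveʳ; map-injective)
open import Data.List.Relation.Unary.All as All using (All; []; _∷_)
open import Data.List.Relation.Unary.All.Properties using (¬Any⇒All¬; All¬⇒¬Any; ++⁻ˡ)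
open import Data.List.Relation.Unary.Any using (Any; here; there; any?)
import Data.List.Relation.Unary.Any as Any
open import Data.List.Relation.Unary.Any.Properties using (any⁺; any⁻; ++⁺ʳ)
open import Data.List.Relation.Unary.AllPairs as AllPairs using (_∷_)
open import Data.List.Relation.Unary.Linked as Linked using (Linked; []; [-]; _∷_)
open import Data.List.Relation.Unary.Linked.Properties as Linkedₚ using (Linked⇒All)
open import Data.List.Relation.Unary.Unique.Propositional using (Unique)
import Data.List.Relation.Unary.Unique.Propositional.Properties as Unique
open import Data.List.Membership.Propositional using (_∈_)
open import Data.List.Membership.Propositional.Properties
  using (∈-map⁺; ∈-map⁻; ∈-upTo⁺; ∈-upTo⁻; ∈-++⁺ʳ; ∈-∃++)
open import Data.List.Membership.Propositional.Properties.WithK using (unique∧set⇒bag)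
open import Data.List.Relation.Binary.BagAndSetEquality using (∼bag⇒↭)
open import Data.List.Relation.Binary.Permutation.Propositional
  using (_↭_; ↭-refl; ↭-sym; ↭-trans; ↭-prep; ↭-swap; ↭⇒↭ₛ)
open import Data.List.Relation.Binary.Permutation.Propositional.Properties
  using (∈-resp-↭; All-resp-↭; ++⁺ˡ) renaming (shift to ↭-shift)
open import Data.List.Relation.Binary.Permutation.Setoid.Properties using (Unique-resp-↭)
open import Data.Product using (Σ; ∃; _×_; _,_; proj₁; proj₂)
open import Function using (_∘_; _$_)
open import Function.Bundles using (Equivalence; mk⇔)
open import Relation.Binary.Core using (Rel; _Preserves_⟶_)
open import Relation.Binary.Definitions using (Transitive; tri<; tri≈; tri>)
open import Relation.Nullary using (¬_; yes; no; contradiction)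
open import Relation.Nullary.Decidable using (T?)
open import Relation.Binary.PropositionalEquality
  using (_≡_; _≢_; refl; sym; trans; cong; cong₂; subst; subst₂; module ≡-Reasoning)
open import Relation.Binary.PropositionalEquality.Properties using (setoid)
open ≡-Reasoning

private
  variable
    ℓ ℓ′ : Level
    A : Set ℓ

module _ {R : Rel A ℓ′} where

  Linked-++⁻ʳ : ∀ xs {ys} → Linked R (xs ++ ys) → Linked R ys
  Linked-++⁻ʳ []               l       = l
  Linked-++⁻ʳ (_ ∷ [])         [-]     = []
  Linked-++⁻ʳ (_ ∷ [])         (_ ∷ l) = l
  Linked-++⁻ʳ (_ ∷ xs@(_ ∷ _)) (_ ∷ l) = Linked-++⁻ʳ xs l

  Linked-insert : ∀ xs {x y} zs → Linked R (xs ++ x ∷ zs) → R x y → All (R y) zs →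
                  Linked R (xs ++ x ∷ y ∷ zs)
  Linked-insert []               []       _       xy _          = xy ∷ [-]
  Linked-insert []               (_ ∷ _)  (_ ∷ l) xy (yz ∷ _)   = xy ∷ yz ∷ l
  Linked-insert (_ ∷ [])         zs       (r ∷ l) xy yzs        = r ∷ Linked-insert [] zs l xy yzs
  Linked-insert (_ ∷ xs@(_ ∷ _)) zs       (r ∷ l) xy yzs        = r ∷ Linked-insert xs zs l xy yzs

  Linked-head-All : Transitive R → ∀ {x xs} → Linked R (x ∷ xs) → All (R x) xs
  Linked-head-All tr [-]       = []
  Linked-head-All tr (xy ∷ l) = Linked⇒All tr xy l

  Linked-remove : Transitive R → ∀ xs {x y} zs → Linked R (xs ++ x ∷ y ∷ zs) →
                  Linked R (xs ++ x ∷ zs)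
  Linked-remove tr []               []       _              = [-]
  Linked-remove tr []               (_ ∷ _)  (xy ∷ yz ∷ l)  = tr xy yz ∷ l
  Linked-remove tr (_ ∷ [])         zs       (r ∷ l)        = r ∷ Linked-remove tr [] zs l
  Linked-remove tr (_ ∷ xs@(_ ∷ _)) zs       (r ∷ l)        = r ∷ Linked-remove tr xs zs l

-- Run minima

-- The run minima of x ∷ w are x followed by those of w, except that x absorbs the first run of w
-- (and its minimum) when it is smaller than that minimum.
absorb : ℕ → List ℕ → List ℕ
absorb x [] = []
absorb x (y ∷ ms) with x <? y
... | yes _ = ms
... | no  _ = y ∷ ms

absorb-< : ∀ {x y} ms → x < y → absorb x (y ∷ ms) ≡ ms
absorb-< {x} {y} ms x<y with x <? y
... | yes _   = refl
... | no  x≮y = contradiction x<y x≮y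

absorb-≮ : ∀ {x y} ms → ¬ x < y → absorb x (y ∷ ms) ≡ y ∷ ms
absorb-≮ {x} {y} ms x≮y with x <? y
... | yes x<y = contradiction x<y x≮y
... | no  _   = refl

absorb-++ : ∀ x y ms ns → absorb x (y ∷ ms ++ ns) ≡ absorb x (y ∷ ms) ++ ns
absorb-++ x y ms ns with x <? y
... | yes _ = refl
... | no  _ = refl

runMins : List ℕ → List ℕ
runMins w = map runMin (runs w)

length-runMins : ∀ w → length (runMins w) ≡ nruns w
length-runMins w = length-map runMin (runs w)

nruns-cong : ∀ u v → runMins u ≡ runMins v → nruns u ≡ nruns v
nruns-cong u v eq = trans (sym (length-runMins u)) (trans (cong length eq) (length-runMins v))

runMins-∷ : ∀ x w → runMins (x ∷ w) ≡ x ∷ absorb x (runMins w)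
runMins-∷ x w with runs w
... | [] = refl
... | [] ∷ rs = refl
... | (y ∷ r) ∷ rs with x <? y
...   | yes _ = refl
...   | no  _ = refl

runMins-cons : ∀ x w {ms} → runMins w ≡ ms → runMins (x ∷ w) ≡ x ∷ absorb x ms
runMins-cons x w refl = runMins-∷ x w

-- front ++ μ ∷ [] are the run minima of L ++ a ∷ [], so μ is the minimum of the run ending at a.
record PrefixMins (L : List ℕ) (a : ℕ) : Set where
  constructor prefixMins
  field
    front      : List ℕ
    μ          : ℕ
    μ≤a        : μ ≤ a
    runMins-++ : ∀ Y → runMins (L ++ a ∷ Y) ≡ front ++ μ ∷ absorb a (runMins Y)

prefixMinsOf : ∀ L a → PrefixMins L a
prefixMinsOf []      a = prefixMins [] a ≤-refl (runMins-∷ a)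
prefixMinsOf (x ∷ L) a with prefixMinsOf L a
... | prefixMins [] μ μ≤a eq with x <? μ
...   | yes x<μ = prefixMins [] x (≤-trans (<⇒≤ x<μ) μ≤a) λ Y →
          trans (runMins-cons x (L ++ a ∷ Y) (eq Y)) (cong (x ∷_) (absorb-< _ x<μ))
...   | no  x≮μ = prefixMins (x ∷ []) μ μ≤a λ Y →
          trans (runMins-cons x (L ++ a ∷ Y) (eq Y)) (cong (x ∷_) (absorb-≮ _ x≮μ))
prefixMinsOf (x ∷ L) a | prefixMins (p ∷ F) μ μ≤a eq =
  prefixMins (x ∷ absorb x (p ∷ F)) μ μ≤a λ Y →
    trans (runMins-cons x (L ++ a ∷ Y) (eq Y)) (cong (x ∷_) (absorb-++ x p F _))

length-insert : ∀ (xs : List A) x y zs → length (xs ++ x ∷ y ∷ zs) ≡ suc (length (xs ++ x ∷ zs))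
length-insert []       x y zs = refl
length-insert (_ ∷ xs) x y zs = cong suc (length-insert xs x y zs)

All-absorb : ∀ {P : ℕ → Set} x {ms} → All P ms → All P (absorb x ms)
All-absorb x []                 = []
All-absorb x {y ∷ ms} (py ∷ pms) with x <? y
... | yes _ = pms
... | no  _ = py ∷ pms

All-runMins : ∀ {P : ℕ → Set} {w} → All P w → All P (runMins w)
All-runMins []                  = []
All-runMins {w = x ∷ w} (px ∷ pw) rewrite runMins-∷ x w = px ∷ All-absorb x (All-runMins pw)

absorb⁻ : ∀ {c x} ms → c ≤ x → All (c <_) (absorb x ms) → All (c <_) ms
absorb⁻ {x = x} []       c≤x _ = []
absorb⁻ {x = x} (y ∷ ms) c≤x h with x <? y
... | yes x<y = ≤-<-trans c≤x x<y ∷ h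
... | no  _   = h

All-runMins⁻ : ∀ {c} w → All (c <_) (runMins w) → All (c <_) w
All-runMins⁻ []      _ = []
All-runMins⁻ (x ∷ w) h rewrite runMins-∷ x w with h
... | c<x ∷ h′ = c<x ∷ All-runMins⁻ w (absorb⁻ (runMins w) (<⇒≤ c<x) h′)

RunSorted⇒head-minimal : ∀ {c} R → RunSorted (c ∷ R) → All (c <_) R
RunSorted⇒head-minimal {c} R rs =
  All-runMins⁻ R (absorb⁻ (runMins R) ≤-refl
    (Linked-head-All <-trans (subst (Linked _<_) (runMins-∷ c R) rs)))

absorb-peak : ∀ {a n c} R → a < n → c ≤ n →
              absorb a (runMins (n ∷ c ∷ R)) ≡ c ∷ absorb c (runMins R)
absorb-peak {a} {n} {c} R a<n c≤n = begin
  absorb a (runMins (n ∷ c ∷ R))               ≡⟨ cong (absorb a) (runMins-∷ n (c ∷ R)) ⟩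
  absorb a (n ∷ absorb n (runMins (c ∷ R)))    ≡⟨ absorb-< _ a<n ⟩
  absorb n (runMins (c ∷ R))                   ≡⟨ cong (absorb n) (runMins-∷ c R) ⟩
  absorb n (c ∷ absorb c (runMins R))          ≡⟨ absorb-≮ _ (≤⇒≯ c≤n) ⟩
  c ∷ absorb c (runMins R)                     ∎

absorb-below : ∀ {a c} R → a < c → All (c <_) R → absorb a (runMins R) ≡ absorb c (runMins R)
absorb-below []      a<c _           = refl
absorb-below (r ∷ R) a<c (c<r ∷ _) rewrite runMins-∷ r R =
  trans (absorb-< _ (<-trans a<c c<r)) (sym (absorb-< _ c<r))

module _ (L : List ℕ) (a : ℕ) where
  open PrefixMins (prefixMinsOf L a)

  runMins-peak : ∀ {n c} R → a < n → c ≤ n →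
                 runMins (L ++ a ∷ n ∷ c ∷ R) ≡ front ++ μ ∷ c ∷ absorb c (runMins R)
  runMins-peak R a<n c≤n =
    trans (runMins-++ (_ ∷ _ ∷ R)) (cong (λ ms → front ++ μ ∷ ms) (absorb-peak R a<n c≤n))

  runMins-valley : ∀ {c} R → a < c → All (c <_) R →
                   runMins (L ++ a ∷ R) ≡ front ++ μ ∷ absorb c (runMins R)
  runMins-valley R a<c c<R =
    trans (runMins-++ R) (cong (λ ms → front ++ μ ∷ ms) (absorb-below R a<c c<R))

  runMins-∷-after : ∀ c R →
                    runMins (L ++ a ∷ c ∷ R) ≡ front ++ μ ∷ absorb a (c ∷ absorb c (runMins R))
  runMins-∷-after c R =
    trans (runMins-++ (c ∷ R)) (cong (λ ms → front ++ μ ∷ absorb a ms) (runMins-∷ c R))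

  nruns-ascent : ∀ {c} R → a < c → All (c <_) R → nruns (L ++ a ∷ c ∷ R) ≡ nruns (L ++ a ∷ R)
  nruns-ascent {c} R a<c c<R = nruns-cong (L ++ a ∷ c ∷ R) (L ++ a ∷ R) $ begin
    runMins (L ++ a ∷ c ∷ R)                          ≡⟨ runMins-∷-after c R ⟩
    front ++ μ ∷ absorb a (c ∷ absorb c (runMins R))  ≡⟨ cong (λ ms → front ++ μ ∷ ms) (absorb-< _ a<c) ⟩
    front ++ μ ∷ absorb c (runMins R)                 ≡⟨ runMins-valley R a<c c<R ⟨
    runMins (L ++ a ∷ R)                              ∎

  nruns-descent : ∀ {n c} R → a < n → c ≤ n → ¬ a < c →
                  nruns (L ++ a ∷ c ∷ R) ≡ nruns (L ++ a ∷ n ∷ c ∷ R)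
  nruns-descent {n} {c} R a<n c≤n a≮c =
    nruns-cong (L ++ a ∷ c ∷ R) (L ++ a ∷ n ∷ c ∷ R) $ begin
    runMins (L ++ a ∷ c ∷ R)                          ≡⟨ runMins-∷-after c R ⟩
    front ++ μ ∷ absorb a (c ∷ absorb c (runMins R))  ≡⟨ cong (λ ms → front ++ μ ∷ ms) (absorb-≮ _ a≮c) ⟩
    front ++ μ ∷ c ∷ absorb c (runMins R)             ≡⟨ runMins-peak R a<n c≤n ⟨
    runMins (L ++ a ∷ n ∷ c ∷ R)                      ∎

  nruns-append-max : ∀ {n} → a < n → nruns (L ++ a ∷ n ∷ []) ≡ nruns (L ++ a ∷ [])
  nruns-append-max {n} a<n = nruns-cong (L ++ a ∷ n ∷ []) (L ++ a ∷ []) $ begin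
    runMins (L ++ a ∷ n ∷ [])                         ≡⟨ runMins-++ (n ∷ []) ⟩
    front ++ μ ∷ absorb a (n ∷ [])                    ≡⟨ cong (λ ms → front ++ μ ∷ ms) (absorb-< [] a<n) ⟩
    front ++ μ ∷ []                                   ≡⟨ runMins-++ [] ⟨
    runMins (L ++ a ∷ [])                             ∎

  nruns-peak : ∀ {n c} R → a < n → c ≤ n → a < c → All (c <_) R →
               nruns (L ++ a ∷ n ∷ c ∷ R) ≡ suc (nruns (L ++ a ∷ R))
  nruns-peak {n} {c} R a<n c≤n a<c c<R = begin
    nruns (L ++ a ∷ n ∷ c ∷ R)                        ≡⟨ length-runMins (L ++ a ∷ n ∷ c ∷ R) ⟨
    length (runMins (L ++ a ∷ n ∷ c ∷ R))             ≡⟨ cong length (runMins-peak R a<n c≤n) ⟩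
    length (front ++ μ ∷ c ∷ absorb c (runMins R))    ≡⟨ length-insert front μ c _ ⟩
    suc (length (front ++ μ ∷ absorb c (runMins R)))  ≡⟨ cong (suc ∘ length) (runMins-valley R a<c c<R) ⟨
    suc (length (runMins (L ++ a ∷ R)))               ≡⟨ cong suc (length-runMins (L ++ a ∷ R)) ⟩
    suc (nruns (L ++ a ∷ R))                          ∎

  RunSorted-peak⁺ : ∀ {n c} R → a < c → c < n → All (c <_) R →
                    RunSorted (L ++ a ∷ R) → RunSorted (L ++ a ∷ n ∷ c ∷ R)
  RunSorted-peak⁺ R a<c c<n c<R rs =
    subst (Linked _<_) (sym (runMins-peak R (<-trans a<c c<n) (<⇒≤ c<n)))
      (Linked-insert front _ (subst (Linked _<_) (runMins-valley R a<c c<R) rs)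
        (≤-<-trans μ≤a a<c) (All-absorb _ (All-runMins c<R)))

  RunSorted-peak⁻ : ∀ {n c} R → a < n → c ≤ n → a < c → All (c <_) R →
                    RunSorted (L ++ a ∷ n ∷ c ∷ R) → RunSorted (L ++ a ∷ R)
  RunSorted-peak⁻ R a<n c≤n a<c c<R rs =
    subst (Linked _<_) (sym (runMins-valley R a<c c<R))
      (Linked-remove <-trans front _ (subst (Linked _<_) (runMins-peak R a<n c≤n) rs))

  RunSorted-peak⇒valley : ∀ {n c} R → a < n → c ≤ n →
                          RunSorted (L ++ a ∷ n ∷ c ∷ R) → All (c <_) R
  RunSorted-peak⇒valley {c = c} R a<n c≤n rs =
    RunSorted⇒head-minimal R (subst (Linked _<_) (sym (runMins-∷ c R))
      (Linked.tail (Linked-++⁻ʳ front (subst (Linked _<_) (runMins-peak R a<n c≤n) rs))))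

module _ {f : ℕ → ℕ} (f-mono : f Preserves _<_ ⟶ _<_) (f-reflects : ∀ {x y} → f x < f y → x < y)
         where

  absorb-map : ∀ x ms → absorb (f x) (map f ms) ≡ map f (absorb x ms)
  absorb-map x []       = refl
  absorb-map x (y ∷ ms) with x <? y | f x <? f y
  ... | yes _   | yes _     = refl
  ... | yes x<y | no  fx≮fy = contradiction (f-mono x<y) fx≮fy
  ... | no  x≮y | yes fx<fy = contradiction (f-reflects fx<fy) x≮y
  ... | no  _   | no  _     = refl

  runMins-map : ∀ w → runMins (map f w) ≡ map f (runMins w)
  runMins-map []      = refl
  runMins-map (x ∷ w) = begin
    runMins (f x ∷ map f w)                   ≡⟨ runMins-∷ (f x) (map f w) ⟩
    f x ∷ absorb (f x) (runMins (map f w))    ≡⟨ cong (λ ms → f x ∷ absorb (f x) ms) (runMins-map w) ⟩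
    f x ∷ absorb (f x) (map f (runMins w))    ≡⟨ cong (f x ∷_) (absorb-map x (runMins w)) ⟩
    map f (x ∷ absorb x (runMins w))          ≡⟨ cong (map f) (runMins-∷ x w) ⟨
    map f (runMins (x ∷ w))                   ∎

  RunSorted-map⁺ : ∀ w → RunSorted w → RunSorted (map f w)
  RunSorted-map⁺ w rs = subst (Linked _<_) (sym (runMins-map w)) (Linkedₚ.map⁺ (Linked.map f-mono rs))

  RunSorted-map⁻ : ∀ w → RunSorted (map f w) → RunSorted w
  RunSorted-map⁻ w rs = Linked.map f-reflects (Linkedₚ.map⁻ (subst (Linked _<_) (runMins-map w) rs))

  nruns-map : ∀ w → nruns (map f w) ≡ nruns w
  nruns-map w = begin
    nruns (map f w)            ≡⟨ length-runMins (map f w) ⟨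
    length (runMins (map f w)) ≡⟨ cong length (runMins-map w) ⟩
    length (map f (runMins w)) ≡⟨ length-map f (runMins w) ⟩
    length (runMins w)         ≡⟨ length-runMins w ⟩
    nruns w                    ∎

-- The relabelling x ↦ x + [x > i]

shift : ℕ → ℕ → ℕ
shift i x = if i <ᵇ x then suc x else x

shift-≤ : ∀ {i x} → x ≤ i → shift i x ≡ x
shift-≤ {i} {x} x≤i with i <ᵇ x | <ᵇ⇒< i x
... | true  | i<x = contradiction (i<x _) (≤⇒≯ x≤i)
... | false | _   = refl

shift-> : ∀ {i x} → i < x → shift i x ≡ suc x
shift-> {i} {x} i<x with i <ᵇ x | <⇒<ᵇ i<x
... | true | _ = refl

shift-mono : ∀ i → shift i Preserves _<_ ⟶ _<_
shift-mono i {x} {y} x<y with x ≤? i | y ≤? i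
... | yes x≤i | yes y≤i rewrite shift-≤ x≤i | shift-≤ y≤i = x<y
... | yes x≤i | no  y≰i rewrite shift-≤ x≤i | shift-> (≰⇒> y≰i) = m<n⇒m<1+n x<y
... | no  x≰i | yes y≤i = contradiction (<-trans (≰⇒> x≰i) x<y) (≤⇒≯ y≤i)
... | no  x≰i | no  y≰i rewrite shift-> (≰⇒> x≰i) | shift-> (≰⇒> y≰i) = s≤s x<y

shift-reflects : ∀ i {x y} → shift i x < shift i y → x < y
shift-reflects i {x} {y} sx<sy with <-cmp x y
... | tri< x<y _    _   = x<y
... | tri≈ _   refl _   = contradiction sx<sy (<-irrefl refl)
... | tri> _   _    y<x = contradiction sx<sy (<-asym (shift-mono i y<x))

shift-injective : ∀ i {x y} → shift i x ≡ shift i y → x ≡ y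
shift-injective i {x} {y} sx≡sy with <-cmp x y
... | tri< x<y _   _   = contradiction sx≡sy (<⇒≢ (shift-mono i x<y))
... | tri≈ _   x≡y _   = x≡y
... | tri> _   _   y<x = contradiction (sym sx≡sy) (<⇒≢ (shift-mono i y<x))

shift-≢ : ∀ i x → shift i x ≢ suc i
shift-≢ i x with x ≤? i
... | yes x≤i rewrite shift-≤ x≤i = <⇒≢ (s≤s x≤i)
... | no  x≰i rewrite shift-> (≰⇒> x≰i) = <⇒≢ (s≤s (≰⇒> x≰i)) ∘ sym

shift-inflationary : ∀ i x → x ≤ shift i x
shift-inflationary i x with x ≤? i
... | yes x≤i rewrite shift-≤ x≤i = ≤-refl
... | no  x≰i rewrite shift-> (≰⇒> x≰i) = n≤1+n x

shift-positive⁻ : ∀ i x → 1 ≤ shift i x → 1 ≤ x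
shift-positive⁻ i zero    h rewrite shift-≤ {i} z≤n = h
shift-positive⁻ i (suc x) _ = s≤s z≤n

shift-bounded : ∀ {i m x} → i ≤ m → x ≤ m → shift i x ≤ suc m
shift-bounded {i} {m} {x} i≤m x≤m with x ≤? i
... | yes x≤i rewrite shift-≤ x≤i = m≤n⇒m≤1+n x≤m
... | no  x≰i rewrite shift-> (≰⇒> x≰i) = s≤s x≤m

shift-bounded⁻ : ∀ {i m x} → i ≤ m → shift i x ≤ suc m → x ≤ m
shift-bounded⁻ {i} {m} {x} i≤m sx≤1+m with x ≤? i
... | yes x≤i = ≤-trans x≤i i≤m
... | no  x≰i rewrite shift-> (≰⇒> x≰i) = ≤-pred sx≤1+m

shift-surjective : ∀ i {y} → y ≢ suc i → ∃ λ x → shift i x ≡ y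
shift-surjective i {y} y≢1+i with y ≤? i
... | yes y≤i = y , shift-≤ y≤i
shift-surjective i {zero}  _     | no 0≰i = contradiction z≤n 0≰i
shift-surjective i {suc x} y≢1+i | no y≰i =
  x , shift-> (≤∧≢⇒< (≤-pred (≰⇒> y≰i)) (y≢1+i ∘ cong suc ∘ sym))

map-shift-surjective : ∀ i w → All (_≢ suc i) w → ∃ λ π → map (shift i) π ≡ w
map-shift-surjective i []      []         = [] , refl
map-shift-surjective i (y ∷ w) (y≢ ∷ w≢) with shift-surjective i y≢ | map-shift-surjective i w w≢
... | x , sx≡y | π , sπ≡w = x ∷ π , cong₂ _∷_ sx≡y sπ≡w

-- Permutations of [m]

∈-[]⁻ : ∀ {m x} → x ∈ [ m ] → 1 ≤ x × x ≤ m
∈-[]⁻ x∈ with ∈-map⁻ suc x∈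
... | y , y∈ , refl = s≤s z≤n , ∈-upTo⁻ y∈

∈-[]⁺ : ∀ {m x} → 1 ≤ x → x ≤ m → x ∈ [ m ]
∈-[]⁺ {x = suc y} _ x≤m = ∈-map⁺ suc (∈-upTo⁺ x≤m)

Unique-[] : ∀ m → Unique [ m ]
Unique-[] m = Unique.map⁺ suc-injective (Unique.upTo⁺ m)

Unique-resp : ∀ {xs ys : List ℕ} → xs ↭ ys → Unique xs → Unique ys
Unique-resp p = Unique-resp-↭ (setoid ℕ) (↭⇒↭ₛ p)

↭-[] : ∀ {m σ} → Unique σ → (∀ {x} → x ∈ σ → 1 ≤ x × x ≤ m) → (∀ {x} → 1 ≤ x → x ≤ m → x ∈ σ) →
       σ ↭ [ m ]
↭-[] {m} σ-unique sound complete = ∼bag⇒↭ (unique∧set⇒bag σ-unique (Unique-[] m)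
  (mk⇔ (λ x∈σ → let 1≤x , x≤m = sound x∈σ in ∈-[]⁺ 1≤x x≤m)
       (λ x∈[m] → let 1≤x , x≤m = ∈-[]⁻ x∈[m] in complete 1≤x x≤m)))

module _ {m i : ℕ} {π : List ℕ} (i≤m : i ≤ m) where

  ∈-shift⁻ : π ↭ [ m ] → ∀ {y} → y ∈ map (shift i) π → 1 ≤ y × y ≤ suc m × y ≢ suc i
  ∈-shift⁻ π↭ y∈ with ∈-map⁻ (shift i) y∈
  ... | x , x∈π , refl with ∈-[]⁻ (∈-resp-↭ π↭ x∈π)
  ...   | 1≤x , x≤m = ≤-trans 1≤x (shift-inflationary i x) , shift-bounded i≤m x≤m , shift-≢ i x

  ∈-shift⁺ : π ↭ [ m ] → ∀ {y} → 1 ≤ y → y ≤ suc m → y ≢ suc i → y ∈ map (shift i) π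
  ∈-shift⁺ π↭ 1≤y y≤1+m y≢1+i with shift-surjective i y≢1+i
  ... | x , refl = ∈-map⁺ (shift i)
        (∈-resp-↭ (↭-sym π↭) (∈-[]⁺ (shift-positive⁻ i x 1≤y) (shift-bounded⁻ i≤m y≤1+m)))

  shift-avoids-top : π ↭ [ m ] → All (suc (suc m) ≢_) (map (shift i) π)
  shift-avoids-top π↭ =
    All.tabulate λ y∈ n≡y → <-irrefl (sym n≡y) (s≤s (proj₁ (proj₂ (∈-shift⁻ π↭ y∈))))

  perm-shift⁺ : π ↭ [ m ] → suc (suc m) ∷ suc i ∷ map (shift i) π ↭ [ suc (suc m) ]
  perm-shift⁺ π↭ = ↭-[] ((n≢c ∷ shift-avoids-top π↭) ∷ (c∉w ∷ w-unique)) sound complete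
    where
    n c : ℕ
    n = suc (suc m)
    c = suc i
    n≢c : n ≢ c
    n≢c n≡c = <-irrefl (sym n≡c) (s≤s (s≤s i≤m))
    c∉w : All (c ≢_) (map (shift i) π)
    c∉w = All.tabulate λ y∈ c≡y → proj₂ (proj₂ (∈-shift⁻ π↭ y∈)) (sym c≡y)
    w-unique : Unique (map (shift i) π)
    w-unique = Unique.map⁺ (shift-injective i) (Unique-resp (↭-sym π↭) (Unique-[] m))
    sound : ∀ {x} → x ∈ n ∷ c ∷ map (shift i) π → 1 ≤ x × x ≤ n
    sound (here refl)         = s≤s z≤n , ≤-refl
    sound (there (here refl)) = s≤s z≤n , s≤s (m≤n⇒m≤1+n i≤m)
    sound (there (there y∈))  = let 1≤y , y≤1+m , _ = ∈-shift⁻ π↭ y∈ in 1≤y , m≤n⇒m≤1+n y≤1+m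
    complete : ∀ {x} → 1 ≤ x → x ≤ n → x ∈ n ∷ c ∷ map (shift i) π
    complete {x} 1≤x x≤n with x ≟ n | x ≟ c
    ... | yes refl | _        = here refl
    ... | no  _    | yes refl = there (here refl)
    ... | no  x≢n  | no  x≢c  = there (there (∈-shift⁺ π↭ 1≤x (≤-pred (≤∧≢⇒< x≤n x≢n)) x≢c))

  perm-shift⁻ : suc (suc m) ∷ suc i ∷ map (shift i) π ↭ [ suc (suc m) ] → π ↭ [ m ]
  perm-shift⁻ σ↭ with Unique-resp (↭-sym σ↭) (Unique-[] (suc (suc m)))
  ... | (_ ∷ n∉w) ∷ (_ ∷ w-unique) = ↭-[] (Unique.map⁻ w-unique) sound complete
    where
    in-σ : ∀ {x} → x ∈ π → shift i x ∈ suc (suc m) ∷ suc i ∷ map (shift i) π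
    in-σ = there ∘ there ∘ ∈-map⁺ (shift i)
    sound : ∀ {x} → x ∈ π → 1 ≤ x × x ≤ m
    sound {x} x∈π =
      let 1≤sx , sx≤n = ∈-[]⁻ (∈-resp-↭ σ↭ (in-σ x∈π))
          n≢sx = All.lookup n∉w (∈-map⁺ (shift i) x∈π)
      in shift-positive⁻ i x 1≤sx , shift-bounded⁻ i≤m (≤-pred (≤∧≢⇒< sx≤n (n≢sx ∘ sym)))
    complete : ∀ {x} → 1 ≤ x → x ≤ m → x ∈ π
    complete {x} 1≤x x≤m
      with ∈-resp-↭ (↭-sym σ↭) (∈-[]⁺ {suc (suc m)} (≤-trans 1≤x (shift-inflationary i x))
                                                   (m≤n⇒m≤1+n (shift-bounded i≤m x≤m)))
    ... | here sx≡n         =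
      contradiction (subst (_≤ suc m) sx≡n (shift-bounded i≤m x≤m)) (<-irrefl refl)
    ... | there (here sx≡c) = contradiction sx≡c (shift-≢ i x)
    ... | there (there sx∈w) with ∈-map⁻ (shift i) sx∈w
    ...   | z , z∈π , sx≡sz = subst (_∈ π) (sym (shift-injective i sx≡sz)) z∈π

↭-lift : ∀ L (a n : ℕ) Y → L ++ a ∷ n ∷ Y ↭ n ∷ L ++ a ∷ Y
↭-lift L a n Y = ↭-trans (++⁺ˡ L (↭-swap a n ↭-refl)) (↭-shift n L (a ∷ Y))

↭-peak : ∀ L (a n c : ℕ) R → L ++ a ∷ n ∷ c ∷ R ↭ n ∷ c ∷ L ++ a ∷ R
↭-peak L a n c R = ↭-trans (↭-lift L a n (c ∷ R)) (↭-prep n (↭-lift L a c R))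

-- Insertion and deletion

insertAfterLast-split : ∀ (p : ℕ → Bool) ws L {a} R → T (p a) → All (¬_ ∘ T ∘ p) R →
                        insertAfterLast p ws (L ++ a ∷ R) ≡ L ++ a ∷ ws ++ R
insertAfterLast-split p ws [] {a} R pa ¬pR with p a | any p R | any⁻ p R
... | false | _     | _     = ⊥-elim pa
... | true  | false | _     = refl
... | true  | true  | p∈R   = contradiction (p∈R _) (All¬⇒¬Any ¬pR)
insertAfterLast-split p ws (x ∷ L) {a} R pa ¬pR
  with any p (L ++ a ∷ R) | any⁺ p (++⁺ʳ L {a ∷ R} (here pa))
... | false | ()
... | true  | _ rewrite ∧-zeroʳ (p x) = cong (x ∷_) (insertAfterLast-split p ws L R pa ¬pR)

split-at-last : ∀ (p : ℕ → Bool) {xs} → Any (T ∘ p) xs →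
                ∃ λ L → ∃ λ a → ∃ λ R → xs ≡ L ++ a ∷ R × T (p a) × All (¬_ ∘ T ∘ p) R
split-at-last p {x ∷ xs} p∈x∷xs with any? (T? ∘ p) xs | p∈x∷xs
... | yes p∈xs | _ = let L , a , R , xs≡ , pa , ¬pR = split-at-last p p∈xs in
                     x ∷ L , a , R , cong (x ∷_) xs≡ , pa , ¬pR
... | no  p∉xs | here px    = [] , x , xs , refl , px , ¬Any⇒All¬ xs p∉xs
... | no  p∉xs | there p∈xs = contradiction p∈xs p∉xs

deleteEntry-skip : ∀ {n y} Y → n ≢ y → deleteEntry n (y ∷ Y) ≡ y ∷ deleteEntry n Y
deleteEntry-skip {n} {y} Y n≢y with y ≡ᵇ n | ≡ᵇ⇒≡ y n
... | true  | y≡n = contradiction (sym (y≡n _)) n≢y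
... | false | _   = refl

deleteEntry-self : ∀ n Y → deleteEntry n (n ∷ Y) ≡ deleteEntry n Y
deleteEntry-self n Y with n ≡ᵇ n | ≡⇒≡ᵇ n n refl
... | true | _ = refl

deleteEntry-∉ : ∀ {n} Y → All (n ≢_) Y → deleteEntry n Y ≡ Y
deleteEntry-∉ []      []          = refl
deleteEntry-∉ (y ∷ Y) (n≢y ∷ n∉Y) =
  trans (deleteEntry-skip Y n≢y) (cong (y ∷_) (deleteEntry-∉ Y n∉Y))

deleteEntry-peak : ∀ {n} L a Y → All (n ≢_) (L ++ a ∷ Y) →
                   deleteEntry n (L ++ a ∷ n ∷ Y) ≡ L ++ a ∷ Y
deleteEntry-peak {n} [] a Y (n≢a ∷ n∉Y) = begin
  deleteEntry n (a ∷ n ∷ Y)  ≡⟨ deleteEntry-skip (n ∷ Y) n≢a ⟩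
  a ∷ deleteEntry n (n ∷ Y)  ≡⟨ cong (a ∷_) (deleteEntry-self n Y) ⟩
  a ∷ deleteEntry n Y        ≡⟨ cong (a ∷_) (deleteEntry-∉ Y n∉Y) ⟩
  a ∷ Y                      ∎
deleteEntry-peak (x ∷ L) a Y (n≢x ∷ n∉) =
  trans (deleteEntry-skip (L ++ a ∷ _ ∷ Y) n≢x) (cong (x ∷_) (deleteEntry-peak L a Y n∉))

++-cancel-at : ∀ {n : ℕ} X X′ {Y Y′} → All (n ≢_) X → All (n ≢_) X′ →
               X ++ n ∷ Y ≡ X′ ++ n ∷ Y′ → X ≡ X′ × Y ≡ Y′
++-cancel-at []      []       _           _            eq = refl , ∷-injectiveʳ eq
++-cancel-at []      (x′ ∷ _) _           (n≢x′ ∷ _)   eq = contradiction (∷-injectiveˡ eq) n≢x′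
++-cancel-at (x ∷ _) []       (n≢x ∷ _)   _            eq = contradiction (sym (∷-injectiveˡ eq)) n≢x
++-cancel-at (x ∷ X) (x′ ∷ X′) (_ ∷ n∉X)  (_ ∷ n∉X′)   eq =
  let X≡X′ , Y≡Y′ = ++-cancel-at X X′ n∉X n∉X′ (∷-injectiveʳ eq) in
  cong₂ _∷_ (∷-injectiveˡ eq) X≡X′ , Y≡Y′

peak-unique : ∀ {n c c′ : ℕ} L L′ {a a′} R R′ →
              All (n ≢_) (L ++ a ∷ R) → All (n ≢_) (L′ ++ a′ ∷ R′) →
              L ++ a ∷ n ∷ c ∷ R ≡ L′ ++ a′ ∷ n ∷ c′ ∷ R′ →
              c ≡ c′ × L ++ a ∷ R ≡ L′ ++ a′ ∷ R′
peak-unique {n} {c} {c′} L L′ {a} {a′} R R′ n∉w n∉w′ σ≡σ′ =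
  ∷-injectiveˡ (proj₂ cancelled) , (begin
    L ++ a ∷ R                   ≡⟨ regroup L a R ⟩
    (L ++ a ∷ []) ++ R           ≡⟨ cong₂ _++_ (proj₁ cancelled) (∷-injectiveʳ (proj₂ cancelled)) ⟩
    (L′ ++ a′ ∷ []) ++ R′        ≡⟨ regroup L′ a′ R′ ⟨
    L′ ++ a′ ∷ R′                ∎)
  where
  regroup : ∀ L (a : ℕ) Y → L ++ a ∷ Y ≡ (L ++ a ∷ []) ++ Y
  regroup L a Y = sym (++-assoc L (a ∷ []) Y)
  n∉front : ∀ L {a} R → All (n ≢_) (L ++ a ∷ R) → All (n ≢_) (L ++ a ∷ [])
  n∉front L {a} R = ++⁻ˡ (L ++ a ∷ []) ∘ subst (All (n ≢_)) (regroup L a R)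
  cancelled : L ++ a ∷ [] ≡ L′ ++ a′ ∷ [] × c ∷ R ≡ c′ ∷ R′
  cancelled = ++-cancel-at (L ++ a ∷ []) (L′ ++ a′ ∷ []) (n∉front L R n∉w) (n∉front L′ R′ n∉w′)
                (trans (sym (regroup L a _)) (trans σ≡σ′ (regroup L′ a′ _)))

-- The map ψ

low : ℕ → ℕ → Bool
low i x = (1 ≤ᵇ x) ∧ (x ≤ᵇ i)

low⁺ : ∀ {i x} → 1 ≤ x → x ≤ i → T (low i x)
low⁺ 1≤x x≤i = Equivalence.from T-∧ (≤⇒≤ᵇ 1≤x , ≤⇒≤ᵇ x≤i)

low⁻ : ∀ {i x} → T (low i x) → 1 ≤ x × x ≤ i
low⁻ {i} {x} lx = let 1≤ᵇx , x≤ᵇi = Equivalence.to T-∧ lx in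
  ≤ᵇ⇒≤ 1 x 1≤ᵇx , ≤ᵇ⇒≤ x i x≤ᵇi

ψ-split : ∀ n {i π L a R} → map (shift i) π ≡ L ++ a ∷ R → 1 ≤ a → a ≤ i → All (suc i <_) R →
          ψ n i π ≡ L ++ a ∷ n ∷ suc i ∷ R
ψ-split n {i} {L = L} {R = R} π≡ 1≤a a≤i c<R =
  trans (cong (insertAfterLast (low i) (n ∷ suc i ∷ [])) π≡)
        (insertAfterLast-split (low i) _ L R (low⁺ 1≤a a≤i)
          (All.map (λ c<y → <⇒≱ c<y ∘ m≤n⇒m≤1+n ∘ proj₂ ∘ low⁻) c<R))

record ψ-Shape (m i : ℕ) (π : List ℕ) : Set where
  field
    L      : List ℕ
    a      : ℕ
    R      : List ℕ
    shift≡ : map (shift i) π ≡ L ++ a ∷ R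
    a<c    : a < suc i
    c<R    : All (suc i <_) R
    ψ≡     : ψ (suc (suc m)) i π ≡ L ++ a ∷ suc (suc m) ∷ suc i ∷ R

shift-has-low : ∀ {m i π} → 1 ≤ i → i ≤ m → π ↭ [ m ] → Any (T ∘ low i) (map (shift i) π)
shift-has-low {i = i} 1≤i i≤m π↭ =
  Any.map (λ { refl → low⁺ 1≤i ≤-refl }) (∈-shift⁺ i≤m π↭ 1≤i (m≤n⇒m≤1+n i≤m) (<⇒≢ (n<1+n i)))

ψ-shape : ∀ {m i π} → 1 ≤ i → i ≤ m → π ↭ [ m ] → ψ-Shape m i π
ψ-shape {m} {i} {π} 1≤i i≤m π↭ with split-at-last (low i) (shift-has-low 1≤i i≤m π↭)
... | L , a , R , shift≡ , low-a , high-R with low⁻ low-a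
...   | 1≤a , a≤i = record
  { L = L ; a = a ; R = R ; shift≡ = shift≡ ; a<c = s≤s a≤i ; c<R = c<R
  ; ψ≡ = ψ-split (suc (suc m)) shift≡ 1≤a a≤i c<R }
  where
  c<R : All (suc i <_) R
  c<R = All.tabulate λ {y} y∈R →
    let 1≤y , _ , y≢c = ∈-shift⁻ i≤m π↭ (subst (y ∈_) (sym shift≡) (∈-++⁺ʳ L (there y∈R)))
    in ≤∧≢⇒< (≰⇒> (All.lookup high-R y∈R ∘ low⁺ 1≤y)) (y≢c ∘ sym)

ψ-IsRSP2 : ∀ {m k i π} → 1 ≤ i → i ≤ m → IsRSP m k π →
           IsRSP2 (suc (suc m)) (suc k) (ψ (suc (suc m)) i π)
ψ-IsRSP2 {m} {k} {i} {π} 1≤i i≤m (π↭ , π-sorted , π-runs) =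
  subst (IsRSP2 n (suc k)) (sym ψ≡) ((σ↭ , σ-sorted , σ-runs) , deletion-decreases)
  where
  open ψ-Shape (ψ-shape 1≤i i≤m π↭)
  n c : ℕ
  n = suc (suc m)
  c = suc i
  c<n : c < n
  c<n = s≤s (s≤s i≤m)
  w-sorted : RunSorted (L ++ a ∷ R)
  w-sorted = subst RunSorted shift≡ (RunSorted-map⁺ (shift-mono i) (shift-reflects i) π π-sorted)
  w-runs : nruns (L ++ a ∷ R) ≡ k
  w-runs = trans (cong nruns (sym shift≡)) (trans (nruns-map (shift-mono i) (shift-reflects i) π) π-runs)
  σ↭ : L ++ a ∷ n ∷ c ∷ R ↭ [ n ]
  σ↭ = ↭-trans (↭-peak L a n c R) (subst (λ w → n ∷ c ∷ w ↭ [ n ]) shift≡ (perm-shift⁺ i≤m π↭))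
  σ-sorted : RunSorted (L ++ a ∷ n ∷ c ∷ R)
  σ-sorted = RunSorted-peak⁺ L a R a<c c<n c<R w-sorted
  σ-runs′ : nruns (L ++ a ∷ n ∷ c ∷ R) ≡ suc (nruns (L ++ a ∷ R))
  σ-runs′ = nruns-peak L a R (<-trans a<c c<n) (<⇒≤ c<n) a<c c<R
  σ-runs : nruns (L ++ a ∷ n ∷ c ∷ R) ≡ suc k
  σ-runs = trans σ-runs′ (cong suc w-runs)
  n∉ : All (n ≢_) (L ++ a ∷ c ∷ R)
  n∉ = All-resp-↭ (↭-sym (↭-lift L a c R))
         ((<⇒≢ c<n ∘ sym) ∷ subst (All (n ≢_)) shift≡ (shift-avoids-top i≤m π↭))
  δ-runs : nruns (deleteEntry n (L ++ a ∷ n ∷ c ∷ R)) ≡ nruns (L ++ a ∷ R)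
  δ-runs = trans (cong nruns (deleteEntry-peak L a (c ∷ R) n∉)) (nruns-ascent L a R a<c c<R)
  deletion-decreases : nruns (deleteEntry n (L ++ a ∷ n ∷ c ∷ R)) < nruns (L ++ a ∷ n ∷ c ∷ R)
  deletion-decreases = subst₂ _<_ (sym δ-runs) (sym σ-runs′) (n<1+n (nruns (L ++ a ∷ R)))

ψ-injective : ∀ {m i j π ρ} → 1 ≤ i → i ≤ m → π ↭ [ m ] → 1 ≤ j → j ≤ m → ρ ↭ [ m ] →
              ψ (suc (suc m)) i π ≡ ψ (suc (suc m)) j ρ → i ≡ j × π ≡ ρ
ψ-injective {i = i} {j} {π} {ρ} 1≤i i≤m π↭ 1≤j j≤m ρ↭ ψ≡ψ = i≡j , π≡ρ i≡j
  where
  module A = ψ-Shape (ψ-shape 1≤i i≤m π↭)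
  module B = ψ-Shape (ψ-shape 1≤j j≤m ρ↭)
  peak≡ : suc i ≡ suc j × A.L ++ A.a ∷ A.R ≡ B.L ++ B.a ∷ B.R
  peak≡ = peak-unique A.L B.L A.R B.R
    (subst (All _) A.shift≡ (shift-avoids-top i≤m π↭))
    (subst (All _) B.shift≡ (shift-avoids-top j≤m ρ↭))
    (trans (sym A.ψ≡) (trans ψ≡ψ B.ψ≡))
  i≡j : i ≡ j
  i≡j = suc-injective (proj₁ peak≡)
  π≡ρ : i ≡ j → π ≡ ρ
  π≡ρ refl = map-injective (shift-injective i) (trans A.shift≡ (trans (proj₂ peak≡) (sym B.shift≡)))

top-not-first : ∀ {m} Y → RunSorted (suc (suc m) ∷ Y) → ¬ (suc (suc m) ∷ Y ↭ [ suc (suc m) ])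
top-not-first {m} [] _ σ↭ with ∈-resp-↭ (↭-sym σ↭) (∈-[]⁺ {suc (suc m)} {1} ≤-refl (s≤s z≤n))
... | here ()
top-not-first (y ∷ Y) σ-sorted σ↭ =
  <⇒≱ (All.head (RunSorted⇒head-minimal (y ∷ Y) σ-sorted))
      (proj₂ (∈-[]⁻ (∈-resp-↭ σ↭ (there (here refl)))))

top-not-last : ∀ {m k} L a → ¬ IsRSP2 (suc (suc m)) k (L ++ a ∷ suc (suc m) ∷ [])
top-not-last {m} L a ((σ↭ , _) , deletion-decreases) =
  <-irrefl (trans (cong nruns (deleteEntry-peak L a [] n∉)) (sym (nruns-append-max L a a<n)))
           deletion-decreases
  where
  n : ℕ
  n = suc (suc m)
  σ′↭ : n ∷ L ++ a ∷ [] ↭ [ n ]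
  σ′↭ = ↭-trans (↭-sym (↭-lift L a n [])) σ↭
  n∉ : All (n ≢_) (L ++ a ∷ [])
  n∉ = AllPairs.head (Unique-resp (↭-sym σ′↭) (Unique-[] n))
  a∈ : a ∈ L ++ a ∷ []
  a∈ = ∈-++⁺ʳ L (here refl)
  a<n : a < n
  a<n = ≤∧≢⇒< (proj₂ (∈-[]⁻ (∈-resp-↭ σ′↭ (there a∈)))) (All.lookup n∉ a∈ ∘ sym)

record Peak (m : ℕ) (L : List ℕ) (a c : ℕ) (R : List ℕ) : Set where
  field
    1≤a      : 1 ≤ a
    a<c      : a < c
    c<n      : c < suc (suc m)
    c<R      : All (c <_) R
    c∉w      : All (c ≢_) (L ++ a ∷ R)
    w↭       : suc (suc m) ∷ c ∷ L ++ a ∷ R ↭ [ suc (suc m) ]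
    w-sorted : RunSorted (L ++ a ∷ R)
    σ-runs   : nruns (L ++ a ∷ suc (suc m) ∷ c ∷ R) ≡ suc (nruns (L ++ a ∷ R))

IsRSP2⇒Peak : ∀ {m k} L a c R → IsRSP2 (suc (suc m)) k (L ++ a ∷ suc (suc m) ∷ c ∷ R) →
              Peak m L a c R
IsRSP2⇒Peak {m} L a c R ((σ↭ , σ-sorted , _) , deletion-decreases) = record
  { 1≤a = 1≤a ; a<c = a<c ; c<n = c<n ; c<R = c<R ; c∉w = AllPairs.head (AllPairs.tail σ′-unique)
  ; w↭ = σ′↭ ; w-sorted = RunSorted-peak⁻ L a R a<n (<⇒≤ c<n) a<c c<R σ-sorted
  ; σ-runs = nruns-peak L a R a<n (<⇒≤ c<n) a<c c<R }
  where
  n : ℕ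
  n = suc (suc m)
  σ′↭ : n ∷ c ∷ L ++ a ∷ R ↭ [ n ]
  σ′↭ = ↭-trans (↭-sym (↭-peak L a n c R)) σ↭
  in-range : ∀ {x} → x ∈ n ∷ c ∷ L ++ a ∷ R → 1 ≤ x × x ≤ n
  in-range = ∈-[]⁻ ∘ ∈-resp-↭ σ′↭
  σ′-unique : Unique (n ∷ c ∷ L ++ a ∷ R)
  σ′-unique = Unique-resp (↭-sym σ′↭) (Unique-[] n)
  n∉c∷w : All (n ≢_) (c ∷ L ++ a ∷ R)
  n∉c∷w = AllPairs.head σ′-unique
  below-n : ∀ {x} → x ∈ c ∷ L ++ a ∷ R → x < n
  below-n x∈ = ≤∧≢⇒< (proj₂ (in-range (there x∈))) (All.lookup n∉c∷w x∈ ∘ sym)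
  a∈w : a ∈ L ++ a ∷ R
  a∈w = ∈-++⁺ʳ L (here refl)
  1≤a : 1 ≤ a
  1≤a = proj₁ (in-range (there (there a∈w)))
  a<n : a < n
  a<n = below-n (there a∈w)
  c<n : c < n
  c<n = below-n (here refl)
  δ-runs : nruns (deleteEntry n (L ++ a ∷ n ∷ c ∷ R)) ≡ nruns (L ++ a ∷ c ∷ R)
  δ-runs = cong nruns (deleteEntry-peak L a (c ∷ R) (All-resp-↭ (↭-sym (↭-lift L a c R)) n∉c∷w))
  a<c : a < c
  a<c with a <? c
  ... | yes a<c = a<c
  ... | no  a≮c =
    contradiction (trans δ-runs (nruns-descent L a R a<n (<⇒≤ c<n) a≮c)) (<⇒≢ deletion-decreases)
  c<R : All (c <_) R
  c<R = RunSorted-peak⇒valley L a R a<n (<⇒≤ c<n) σ-sorted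

ψ-Preimage : ℕ → ℕ → List ℕ → Set
ψ-Preimage m k σ =
  Σ ℕ λ i → Σ (List ℕ) λ π → 1 ≤ i × i ≤ m × IsRSP m k π × ψ (suc (suc m)) i π ≡ σ

ψ-surjective-peak : ∀ {m k} L a i R →
                    IsRSP2 (suc (suc m)) (suc k) (L ++ a ∷ suc (suc m) ∷ suc i ∷ R) →
                    ψ-Preimage m k (L ++ a ∷ suc (suc m) ∷ suc i ∷ R)
ψ-surjective-peak {m} {k} L a i R σ-rsp2@((_ , _ , σ-runs′) , _) =
  i , π , ≤-trans 1≤a (≤-pred a<c) , i≤m , (π↭ , π-sorted , π-runs) ,
  ψ-split (suc (suc m)) shift≡ 1≤a (≤-pred a<c) c<R
  where
  open Peak (IsRSP2⇒Peak L a (suc i) R σ-rsp2)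
  unshifted : ∃ λ π → map (shift i) π ≡ L ++ a ∷ R
  unshifted = map-shift-surjective i (L ++ a ∷ R) (All.map (_∘ sym) c∉w)
  π : List ℕ
  π = proj₁ unshifted
  shift≡ : map (shift i) π ≡ L ++ a ∷ R
  shift≡ = proj₂ unshifted
  i≤m : i ≤ m
  i≤m = ≤-pred (≤-pred c<n)
  π↭ : π ↭ [ m ]
  π↭ = perm-shift⁻ i≤m
         (subst (λ w → suc (suc m) ∷ suc i ∷ w ↭ [ suc (suc m) ]) (sym shift≡) w↭)
  π-sorted : RunSorted π
  π-sorted =
    RunSorted-map⁻ (shift-mono i) (shift-reflects i) π (subst RunSorted (sym shift≡) w-sorted)
  π-runs : nruns π ≡ k
  π-runs = suc-injective (begin
    suc (nruns π)                             ≡⟨ cong suc (nruns-map (shift-mono i) (shift-reflects i) π) ⟨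
    suc (nruns (map (shift i) π))             ≡⟨ cong (suc ∘ nruns) shift≡ ⟩
    suc (nruns (L ++ a ∷ R))                  ≡⟨ σ-runs ⟨
    nruns (L ++ a ∷ suc (suc m) ∷ suc i ∷ R)  ≡⟨ σ-runs′ ⟩
    suc k                                     ∎)

ψ-surjective : ∀ {m k} σ → IsRSP2 (suc (suc m)) (suc k) σ → ψ-Preimage m k σ
ψ-surjective {m} {k} σ σ-rsp2@((σ↭ , σ-sorted , _) , _)
  with ∈-∃++ (∈-resp-↭ (↭-sym σ↭) (∈-[]⁺ {suc (suc m)} (s≤s z≤n) ≤-refl))
... | X , Y , refl with initLast X
...   | [] = contradiction σ↭ (top-not-first Y σ-sorted)
...   | L ∷ʳ′ a =
  subst (ψ-Preimage m k) (sym regroup) (after-top Y (subst (IsRSP2 n (suc k)) regroup σ-rsp2))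
  where
  n : ℕ
  n = suc (suc m)
  regroup : (L ∷ʳ a) ++ n ∷ Y ≡ L ++ a ∷ n ∷ Y
  regroup = ++-assoc L (a ∷ []) (n ∷ Y)
  after-top : ∀ Y → IsRSP2 n (suc k) (L ++ a ∷ n ∷ Y) → ψ-Preimage m k (L ++ a ∷ n ∷ Y)
  after-top []          h = contradiction h (top-not-last L a)
  after-top (zero ∷ R)  ((σ↭ , _) , _)
    with ∈-[]⁻ (∈-resp-↭ σ↭ (∈-++⁺ʳ L (there (there (here refl)))))
  ... | () , _
  after-top (suc i ∷ R) h = ψ-surjective-peak L a i R h

proposition23 : (n k : ℕ) → 3 ≤ n → 2 ≤ k →
    ((i : ℕ) (π : List ℕ) → 1 ≤ i → i ≤ n ∸ 2 → IsRSP (n ∸ 2) (k ∸ 1) π →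
       IsRSP2 n k (ψ n i π))
    × ((i j : ℕ) (π ρ : List ℕ) → 1 ≤ i → i ≤ n ∸ 2 → IsRSP (n ∸ 2) (k ∸ 1) π →
       1 ≤ j → j ≤ n ∸ 2 → IsRSP (n ∸ 2) (k ∸ 1) ρ →
       ψ n i π ≡ ψ n j ρ → (i ≡ j × π ≡ ρ))
    × ((σ : List ℕ) → IsRSP2 n k σ →
       Σ ℕ λ i → Σ (List ℕ) λ π → 1 ≤ i × i ≤ n ∸ 2 × IsRSP (n ∸ 2) (k ∸ 1) π × ψ n i π ≡ σ)
proposition23 (suc (suc (suc m))) (suc k) (s≤s (s≤s (s≤s z≤n))) (s≤s (s≤s z≤n)) =
    (λ i π 1≤i i≤m π-rsp → ψ-IsRSP2 1≤i i≤m π-rsp)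
  , (λ i j π ρ 1≤i i≤m π-rsp 1≤j j≤m ρ-rsp →
       ψ-injective 1≤i i≤m (proj₁ π-rsp) 1≤j j≤m (proj₁ ρ-rsp))
  , ψ-surjective
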